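{- Assume (i) $t_{u,v}+t_{v,w}\ge t_{u,w}$ for all $u,v,w\in\{0,\dots,n\}$, and (ii) every single-customer route is warp-free: $\max(t_{0,z},a_z)\le\min(b_z,T-s_z-t_{z,0})$ for all $1\le z\le n$. Then for all $0\le i<j<n$, $pen_{\beta a}(i,j)\le pen_{\beta a}(i,j+1)$, and for all $0<x<y\le n$, $pen_{\beta a}(x,y)\le pen_{\beta a}(x-1,y)$.
   Context: Customers $1,\dots,n$ in tour order, depot $0$; travel times $t_{u,v}\ge0$, service times $s_z\ge0$, time windows $[a_z,b_z]$, day length $T$, penalty factor $\beta\ge 0$. For $0\le i<z\le n$ define $A(i,i+1)=\max(t_{0,i+1},a_{i+1})$, $B(i,i+1)=0$, and for $z\ge i+2$: $A(i,z)=\max(A(i,z-1)-B(i,z-1)+s_{z-1}+t_{z-1,z},\,a_z)$, $B(i,z)=\max\big(0,\,A(i,z)-\min(b_z,T-s_z-t_{z,0})\big)$. The time-warp penalty of the route serving customers $i+1,\dots,j$ is $pen_{\beta a}(i,j)=\beta\sum_{z=i+1}^{j}B(i,z)$.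
   Formalization: The travel times, service times, time windows, day length T and penalty factor β all take rational values. -}

module Defs where

open import Data.Nat using (ℕ; zero; suc; _∸_)
open import Data.Product using (_×_; _,_; proj₁; proj₂)
open import Data.Rational using (ℚ; 0ℚ; _+_; _-_; _*_; _⊔_; _⊓_)

-- Instance data: travel times t u v, service times s z, time windows [a z, b z],
-- day length T.  Indices are natural numbers; only 0..n are meaningful
-- (0 = depot, 1..n = customers in tour order).

-- AB t s a b T i k = (A(i, i+1+k) , B(i, i+1+k)), following the paper's recursion.
AB : (t : ℕ → ℕ → ℚ) (s a b : ℕ → ℚ) (T : ℚ) (i k : ℕ) → ℚ × ℚ
AB t s a b T i zero = (t 0 (suc i) ⊔ a (suc i)) , 0ℚ
AB t s a b T i (suc k) =
  let z  = suc (suc (i Data.Nat.+ k))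
      z₁ = suc (i Data.Nat.+ k)
      prev = AB t s a b T i k
      Az = ((proj₁ prev - proj₂ prev) + s z₁ + t z₁ z) ⊔ a z
  in Az , (0ℚ ⊔ (Az - (b z ⊓ (T - s z - t z 0))))

-- A(i,z) and B(i,z) for z ≥ i+1
A : (t : ℕ → ℕ → ℚ) (s a b : ℕ → ℚ) (T : ℚ) (i z : ℕ) → ℚ
A t s a b T i z = proj₁ (AB t s a b T i (z ∸ suc i))

B : (t : ℕ → ℕ → ℚ) (s a b : ℕ → ℚ) (T : ℚ) (i z : ℕ) → ℚ
B t s a b T i z = proj₂ (AB t s a b T i (z ∸ suc i))

sumB : (t : ℕ → ℕ → ℚ) (s a b : ℕ → ℚ) (T : ℚ) (i m : ℕ) → ℚ
sumB t s a b T i zero = 0ℚ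
sumB t s a b T i (suc m) = sumB t s a b T i m + proj₂ (AB t s a b T i m)

pen : (t : ℕ → ℕ → ℚ) (s a b : ℕ → ℚ) (T β : ℚ) (i j : ℕ) → ℚ
pen t s a b T β i j = β * sumB t s a b T i (j ∸ i)

-- Write L_z = min(b_z, T - s_z - t_{z,0}).  Since B = max(0, A - L), service
-- at customer z starts at A - B = min(A, L_z), a monotone function of the
-- arrival time A.  Compare the route starting at customer c+1 with the
-- route that serves c first.  At c+1 the triangle inequality
-- t_{0,c+1} ≤ t_{0,c} + t_{c,c+1} lets the shorter route arrive no later, and
-- warp-freeness of the single-customer route c+1 lets it start service no later;
-- monotonicity carries both comparisons to every later customer, so there the
-- shorter route warps no more.  The longer route's extra term B(c-1,c) is 0, so
-- summing and scaling by β ≥ 0 gives the second claim; the first only needs B ≥ 0.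

module Submission where

open import Defs
open import Data.Nat using (ℕ; zero; suc; _∸_; z≤n; s≤s)
  renaming (_+_ to _+ℕ_; _≤_ to _≤ℕ_; _<_ to _<ℕ_)
import Data.Nat.Properties as ℕ
open import Data.Rational using (ℚ; 0ℚ; _+_; _-_; -_; _≤_; _⊔_; _⊓_; NonNegative; nonNegative)
open import Data.Rational.Properties
open import Data.Rational.Solver using (module +-*-Solver)
open import Data.Product using (_×_; _,_; proj₁; proj₂)
open import Data.Sum using (inj₁; inj₂)
open import Function.Base using (_∘_)
open import Relation.Binary.PropositionalEquality

p-[p-q]≡q : ∀ p q → p - (p - q) ≡ q
p-[p-q]≡q = solve 2 (λ p q → p :- (p :- q) := q) refl
  where open +-*-Solver

p≤p+q : ∀ p {q} → 0ℚ ≤ q → p ≤ p + q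
p≤p+q p {q} 0≤q = subst (_≤ p + q) (+-identityʳ p) (+-monoʳ-≤ p 0≤q)

p≤q⇒p-q≤0 : ∀ {p q} → p ≤ q → p - q ≤ 0ℚ
p≤q⇒p-q≤0 {p} {q} p≤q = subst (p - q ≤_) (+-inverseʳ q) (+-monoˡ-≤ (- q) p≤q)

p≥q⇒0≤p-q : ∀ {p q} → q ≤ p → 0ℚ ≤ p - q
p≥q⇒0≤p-q {p} {q} q≤p = subst (_≤ p - q) (+-inverseʳ q) (+-monoˡ-≤ (- q) q≤p)

p-[0⊔[p-q]]≡p⊓q : ∀ p q → p - (0ℚ ⊔ (p - q)) ≡ p ⊓ q
p-[0⊔[p-q]]≡p⊓q p q with ≤-total p q
... | inj₁ p≤q = begin
  p - (0ℚ ⊔ (p - q)) ≡⟨ cong (λ r → p - r) (p≥q⇒p⊔q≡p (p≤q⇒p-q≤0 p≤q)) ⟩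
  p - 0ℚ             ≡⟨ +-identityʳ p ⟩
  p                  ≡⟨ p≤q⇒p⊓q≡p p≤q ⟨
  p ⊓ q              ∎
  where open ≡-Reasoning
... | inj₂ q≤p = begin
  p - (0ℚ ⊔ (p - q)) ≡⟨ cong (λ r → p - r) (p≤q⇒p⊔q≡q (p≥q⇒0≤p-q q≤p)) ⟩
  p - (p - q)        ≡⟨ p-[p-q]≡q p q ⟩
  q                  ≡⟨ p≥q⇒p⊓q≡q q≤p ⟨
  p ⊓ q              ∎
  where open ≡-Reasoning

module _ (t : ℕ → ℕ → ℚ) (s a b : ℕ → ℚ) (T : ℚ) where

  latestStart : ℕ → ℚ
  latestStart z = b z ⊓ (T - s z - t z 0)

  -- For the route serving customers i+1, i+2, …, step k concerns customer i+1+k.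
  arrival warp serviceStart : ℕ → ℕ → ℚ
  arrival      i k = proj₁ (AB t s a b T i k)
  warp         i k = proj₂ (AB t s a b T i k)
  serviceStart i k = arrival i k - warp i k

  warp-nonneg : ∀ i k → 0ℚ ≤ warp i k
  warp-nonneg i zero    = ≤-refl
  warp-nonneg i (suc k) = p≤p⊔q 0ℚ (arrival i (suc k) - latestStart (suc (suc (i +ℕ k))))

  -- The customer index is taken as an argument so that both i + suc k and
  -- suc (i + k) can be used for it.
  arrival-suc : ∀ i k {z} → suc (i +ℕ k) ≡ z →
    arrival i (suc k) ≡ (serviceStart i k + s z + t z (suc z)) ⊔ a (suc z)
  arrival-suc i k refl = refl

  warp-suc : ∀ i k {z} → suc (suc (i +ℕ k)) ≡ z →
    warp i (suc k) ≡ 0ℚ ⊔ (arrival i (suc k) - latestStart z)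
  warp-suc i k refl = refl

  serviceStart-suc : ∀ i k {z} → suc (suc (i +ℕ k)) ≡ z →
    serviceStart i (suc k) ≡ arrival i (suc k) ⊓ latestStart z
  serviceStart-suc i k {z} refl = p-[0⊔[p-q]]≡p⊓q (arrival i (suc k)) (latestStart z)

  sumB-≤-sumB-suc : ∀ i m → sumB t s a b T i m ≤ sumB t s a b T i (suc m)
  sumB-≤-sumB-suc i m = p≤p+q (sumB t s a b T i m) (warp-nonneg i m)

  module ShiftedRoute (n : ℕ)
    (s-nonneg : ∀ z → z ≤ℕ n → 0ℚ ≤ s z)
    (t-triangle : ∀ u v w → u ≤ℕ n → v ≤ℕ n → w ≤ℕ n → t u w ≤ t u v + t v w)
    (single-warp-free : ∀ z → 1 ≤ℕ z → z ≤ℕ n → (t 0 z ⊔ a z) ≤ latestStart z)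
    (x : ℕ) where

    direct-arrival-≤ : suc (suc x) ≤ℕ n → arrival (suc x) 0 ≤ arrival x 1
    direct-arrival-≤ x+2≤n = begin
      t 0 z ⊔ a z                           ≤⟨ ⊔-monoˡ-≤ (a z) direct-≤-via-x+1 ⟩
      (serviceStart x 0 + s x+1 + t x+1 z) ⊔ a z  ≡⟨ arrival-suc x 0 (cong suc (ℕ.+-identityʳ x)) ⟨
      arrival x 1                           ∎
      where
      open ≤-Reasoning
      x+1 z : ℕ
      x+1 = suc x
      z   = suc x+1
      x+1≤n : x+1 ≤ℕ n
      x+1≤n = ℕ.<⇒≤ x+2≤n
      direct-≤-via-x+1 : t 0 z ≤ serviceStart x 0 + s x+1 + t x+1 z
      direct-≤-via-x+1 = begin
        t 0 z                         ≤⟨ t-triangle 0 x+1 z z≤n x+1≤n x+2≤n ⟩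
        t 0 x+1 + t x+1 z             ≤⟨ +-monoˡ-≤ (t x+1 z) (p≤p⊔q (t 0 x+1) (a x+1)) ⟩
        arrival x 0 + t x+1 z         ≡⟨ cong (_+ t x+1 z) (+-identityʳ (arrival x 0)) ⟨
        serviceStart x 0 + t x+1 z          ≤⟨ +-monoˡ-≤ (t x+1 z) (p≤p+q (serviceStart x 0) s-x+1-nonneg) ⟩
        serviceStart x 0 + s x+1 + t x+1 z  ∎
        where
        s-x+1-nonneg : 0ℚ ≤ s x+1
        s-x+1-nonneg = s-nonneg x+1 x+1≤n

    shifted-≤ : ∀ k → k +ℕ suc (suc x) ≤ℕ n →
      arrival (suc x) k ≤ arrival x (suc k) × serviceStart (suc x) k ≤ serviceStart x (suc k)
    shifted-≤ zero x+2≤n = arrival-≤ , serviceStart-≤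
      where
      open ≤-Reasoning
      arrival-≤ : arrival (suc x) 0 ≤ arrival x 1
      arrival-≤ = direct-arrival-≤ x+2≤n
      serviceStart-≤ : serviceStart (suc x) 0 ≤ serviceStart x 1
      serviceStart-≤ = begin
        arrival (suc x) 0 - 0ℚ
          ≡⟨ +-identityʳ (arrival (suc x) 0) ⟩
        arrival (suc x) 0
          ≤⟨ ⊓-glb arrival-≤ (single-warp-free (suc (suc x)) (s≤s z≤n) x+2≤n) ⟩
        arrival x 1 ⊓ latestStart (suc (suc x))
          ≡⟨ serviceStart-suc x 0 (cong (suc ∘ suc) (ℕ.+-identityʳ x)) ⟨
        serviceStart x 1
          ∎
    shifted-≤ (suc k) k+x+3≤n = arrival-≤ , serviceStart-≤
      where
      open ≤-Reasoning
      z : ℕ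
      z = suc (suc (x +ℕ k))
      serviceStart-≤-previous : serviceStart (suc x) k ≤ serviceStart x (suc k)
      serviceStart-≤-previous = proj₂ (shifted-≤ k (ℕ.<⇒≤ k+x+3≤n))
      arrival-≤ : arrival (suc x) (suc k) ≤ arrival x (suc (suc k))
      arrival-≤ = begin
        arrival (suc x) (suc k)
          ≡⟨ arrival-suc (suc x) k refl ⟩
        (serviceStart (suc x) k + s z + t z (suc z)) ⊔ a (suc z)
          ≤⟨ ⊔-monoˡ-≤ (a (suc z)) (+-monoˡ-≤ (t z (suc z)) (+-monoˡ-≤ (s z) serviceStart-≤-previous)) ⟩
        (serviceStart x (suc k) + s z + t z (suc z)) ⊔ a (suc z)
          ≡⟨ arrival-suc x (suc k) (cong suc (ℕ.+-suc x k)) ⟨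
        arrival x (suc (suc k))
          ∎
      serviceStart-≤ : serviceStart (suc x) (suc k) ≤ serviceStart x (suc (suc k))
      serviceStart-≤ = begin
        serviceStart (suc x) (suc k)
          ≡⟨ serviceStart-suc (suc x) k refl ⟩
        arrival (suc x) (suc k) ⊓ latestStart (suc z)
          ≤⟨ ⊓-monoˡ-≤ (latestStart (suc z)) arrival-≤ ⟩
        arrival x (suc (suc k)) ⊓ latestStart (suc z)
          ≡⟨ serviceStart-suc x (suc k) (cong (suc ∘ suc) (ℕ.+-suc x k)) ⟨
        serviceStart x (suc (suc k))
          ∎

    warp-shifted-≤ : ∀ k → k +ℕ suc (suc x) ≤ℕ n → warp (suc x) k ≤ warp x (suc k)
    warp-shifted-≤ zero    _         = warp-nonneg x 1
    warp-shifted-≤ (suc k) k+x+3≤n = begin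
      warp (suc x) (suc k)
        ≡⟨ warp-suc (suc x) k refl ⟩
      0ℚ ⊔ (arrival (suc x) (suc k) - latestStart z)
        ≤⟨ ⊔-monoʳ-≤ 0ℚ (+-monoˡ-≤ (- latestStart z) arrival-≤) ⟩
      0ℚ ⊔ (arrival x (suc (suc k)) - latestStart z)
        ≡⟨ warp-suc x (suc k) (cong (suc ∘ suc) (ℕ.+-suc x k)) ⟨
      warp x (suc (suc k))
        ∎
      where
      open ≤-Reasoning
      z : ℕ
      z = suc (suc (suc (x +ℕ k)))
      arrival-≤ : arrival (suc x) (suc k) ≤ arrival x (suc (suc k))
      arrival-≤ = proj₁ (shifted-≤ (suc k) k+x+3≤n)

    sumB-shifted-≤ : ∀ m → m +ℕ suc x ≤ℕ n →
      sumB t s a b T (suc x) m ≤ sumB t s a b T x (suc m)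
    sumB-shifted-≤ zero    _           = p≤p+q 0ℚ (warp-nonneg x 0)
    sumB-shifted-≤ (suc m) m+x+2≤n =
      +-mono-≤ (sumB-shifted-≤ m (ℕ.<⇒≤ m+x+2≤n))
               (warp-shifted-≤ m (subst (_≤ℕ n) (sym (ℕ.+-suc m (suc x))) m+x+2≤n))

lemma14 : (n : ℕ) (t : ℕ → ℕ → ℚ) (s a b : ℕ → ℚ) (T β : ℚ)
    → (∀ u v → u ≤ℕ n → v ≤ℕ n → 0ℚ ≤ t u v)
    → (∀ z → z ≤ℕ n → 0ℚ ≤ s z)
    → 0ℚ ≤ β
    → (∀ u v w → u ≤ℕ n → v ≤ℕ n → w ≤ℕ n → t u w ≤ t u v + t v w)
    → (∀ z → 1 ≤ℕ z → z ≤ℕ n → (t 0 z ⊔ a z) ≤ (b z ⊓ (T - s z - t z 0)))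
    → (∀ i j → i <ℕ j → j <ℕ n → pen t s a b T β i j ≤ pen t s a b T β i (suc j))
    × (∀ x y → 0 <ℕ x → x <ℕ y → y ≤ℕ n → pen t s a b T β x y ≤ pen t s a b T β (x ∸ 1) y)
lemma14 n t s a b T β _ s-nonneg β-nonneg t-triangle single-warp-free = extend , drop-first
  where
  instance
    β-NonNegative : NonNegative β
    β-NonNegative = nonNegative β-nonneg

  open ShiftedRoute t s a b T n s-nonneg t-triangle single-warp-free

  extend : ∀ i j → i <ℕ j → j <ℕ n → pen t s a b T β i j ≤ pen t s a b T β i (suc j)
  extend i j i<j _ rewrite ℕ.+-∸-assoc 1 (ℕ.<⇒≤ i<j) =
    *-monoˡ-≤-nonNeg β (sumB-≤-sumB-suc t s a b T i (j ∸ i))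

  drop-first : ∀ x y → 0 <ℕ x → x <ℕ y → y ≤ℕ n →
    pen t s a b T β x y ≤ pen t s a b T β (x ∸ 1) y
  drop-first (suc x) y _ x+1<y y≤n rewrite ℕ.+-∸-assoc 1 (ℕ.<⇒≤ x+1<y) =
    *-monoˡ-≤-nonNeg β (sumB-shifted-≤ x (y ∸ suc x) y-[x+1]+[x+1]≤n)
    where
    y-[x+1]+[x+1]≤n : (y ∸ suc x) +ℕ suc x ≤ℕ n
    y-[x+1]+[x+1]≤n = subst (_≤ℕ n) (sym (ℕ.m∸n+n≡m (ℕ.<⇒≤ x+1<y))) y≤n
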